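{- Let $\mathcal{I}=(D,\mathcal{S}=(S_1,\dots, S_q),W,k)$ be an instance of r-$\mathcal{H}$-SCC Partitioned Compression. Consider an $\mathcal{H}$-free set $Q$ with $S_1\subseteq Q\subseteq V(D)\setminus (W\setminus S_1)$ such that $N^+(Q)$ is a minimum $S_1$-$(W\setminus S_1)$ separator. Let $X$ be a solution of $\mathcal{I}$ such that $R_D(S_1,X) \cap N^+(Q)=\emptyset$. Then there is a solution $X'$ for $\mathcal{I}$ that contains $N^+(Q)$.
   Context: $\mathcal{H}$ is a fixed finite family of rooted digraphs. A set $X\subseteq V(D)$ is an $\mathcal{H}$-deletion set of $D$ if no strong component of $D-X$ contains a subgraph isomorphic to a graph in $\mathcal{H}$. An instance of r-$\mathcal{H}$-SCC Partitioned Compression is a tuple $(D,\mathcal{S}=(S_1,\dots,S_q),W,k)$ where $W$ is an $\mathcal{H}$-deletion set of size at most $k+1$ and $\mathcal{S}$ is an ordered partition of $W$; a solution is an $\mathcal{H}$-deletion set $X$ with $|X|\le k$, $X\cap W=\emptyset$, and $X$ intersecting all $S_i$-$S_j$ paths in $D$ for every $i<j$. A set $Q$ is $\mathcal{H}$-free if $D[Q]$ contains no graph of $\mathcal{H}$ as a subgraph. An $S$-$T$ separator is a set $C$ disjoint from $S\cup T$ such that $D-C$ has no $S$-$T$ path; $R_D(S,X)$ is the set of vertices reachable from $S$ in $D-X$; $N^+(Q)$ is the set of out-neighbours of $Q$ outside $Q$. -}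

module Defs where

open import Data.Nat using (ℕ; suc; _≤_)
open import Data.Bool using (Bool; true; false)
open import Data.Fin using (Fin; zero; _<_)
open import Data.Fin.Subset using (Subset; _∈_; _∉_; _⊆_; _─_; _∪_; ∣_∣; Nonempty)
open import Data.List using (List)
open import Data.List.Membership.Propositional using () renaming (_∈_ to _∈ₗ_)
open import Data.Product using (Σ; ∃; _×_; _,_)
open import Relation.Binary.PropositionalEquality using (_≡_)
open import Relation.Nullary using (¬_)
open import Function.Definitions using (Injective)

record Digraph (n : ℕ) : Set where
  field
    adj     : Fin n → Fin n → Bool
    noLoops : ∀ v → adj v v ≡ false

open Digraph public

Edge : ∀ {n} → Digraph n → Fin n → Fin n → Set
Edge D u v = adj D u v ≡ true

record RootedDigraph : Set where
  field
    size  : ℕ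
    graph : Digraph size
    root  : Fin size

open RootedDigraph public

Family : Set
Family = List RootedDigraph

record Embedding (H : RootedDigraph) {n : ℕ} (D : Digraph n) : Set where
  field
    map       : Fin (size H) → Fin n
    injective : Injective _≡_ _≡_ map
    preserves : ∀ a b → Edge (graph H) a b → Edge D (map a) (map b)

open Embedding public

data PathAvoid {n : ℕ} (D : Digraph n) (X : Subset n) : Fin n → Fin n → Set where
  here : ∀ {u} → u ∉ X → PathAvoid D X u u
  step : ∀ {u w v} → u ∉ X → Edge D u w → PathAvoid D X w v → PathAvoid D X u v

SameSCC : ∀ {n} → Digraph n → Subset n → Fin n → Fin n → Set
SameSCC D X u v = PathAvoid D X u v × PathAvoid D X v u

IsDeletionSet : ∀ {n} → Family → Digraph n → Subset n → Set
IsDeletionSet ℋ D X =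
  ∀ H → H ∈ₗ ℋ → (e : Embedding H D) →
  ¬ ((∀ a → map e a ∉ X) × (∀ a b → SameSCC D X (map e a) (map e b)))

HFree : ∀ {n} → Family → Digraph n → Subset n → Set
HFree ℋ D Q = ∀ H → H ∈ₗ ℋ → (e : Embedding H D) → ¬ (∀ a → map e a ∈ Q)

PathBetween : ∀ {n} → Digraph n → Subset n → Subset n → Subset n → Set
PathBetween D X S T = ∃ λ s → ∃ λ t → s ∈ S × t ∈ T × PathAvoid D X s t

Disjoint : ∀ {n} → Subset n → Subset n → Set
Disjoint A B = ∀ v → v ∈ A → v ∉ B

IsSeparator : ∀ {n} → Digraph n → Subset n → Subset n → Subset n → Set
IsSeparator D S T C = Disjoint C (S ∪ T) × ¬ PathBetween D C S T

IsMinSeparator : ∀ {n} → Digraph n → Subset n → Subset n → Subset n → Set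
IsMinSeparator D S T C =
  IsSeparator D S T C × (∀ C' → IsSeparator D S T C' → ∣ C ∣ ≤ ∣ C' ∣)

InReach : ∀ {n} → Digraph n → Subset n → Subset n → Fin n → Set
InReach D S X v = ∃ λ s → s ∈ S × PathAvoid D X s v

InOutNbr : ∀ {n} → Digraph n → Subset n → Fin n → Set
InOutNbr D Q v = v ∉ Q × ∃ λ u → u ∈ Q × Edge D u v

-- An ordered partition (S₁,…,S_q) of W (q ≥ 1; parts nonempty, pairwise
-- disjoint, union W).  Parts indexed by Fin q, S₁ = S zero.
IsOrderedPartition : ∀ {n q} → (Fin q → Subset n) → Subset n → Set
IsOrderedPartition {n} S W =
  (∀ i → Nonempty (S i)) ×
  (∀ i j → ¬ (i ≡ j) → Disjoint (S i) (S j)) ×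
  (∀ i → S i ⊆ W) ×
  (∀ v → v ∈ W → ∃ λ i → v ∈ S i)

IsInstance : ∀ {n q} → Family → Digraph n → (Fin q → Subset n) → Subset n → ℕ → Set
IsInstance ℋ D S W k =
  IsDeletionSet ℋ D W × ∣ W ∣ ≤ suc k × IsOrderedPartition S W

IsSolution : ∀ {n q} → Family → Digraph n → (Fin q → Subset n) → Subset n → ℕ →
             Subset n → Set
IsSolution ℋ D S W k X =
  IsDeletionSet ℋ D X × ∣ X ∣ ≤ k × Disjoint X W ×
  (∀ i j → i < j → ¬ PathBetween D X (S i) (S j))

module Submission where

open import Defs
open import Data.Nat using (ℕ; suc; _+_; _≤_; z≤n; s≤s)
open import Data.Nat.Properties using (≤-trans; +-monoʳ-≤; +-suc; m≤n⇒m≤1+n; module ≤-Reasoning)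
open import Data.Vec using ([]; _∷_)
open import Data.Fin using (Fin; zero; suc; _<_)
open import Data.Fin.Subset using (Subset; _∈_; _∉_; _⊆_; _─_; _∪_; _∩_; ∣_∣; inside; outside)
open import Data.Fin.Subset.Properties
  using (_∈?_; x∈p∪q⁻; x∈p∪q⁺; x∈p∩q⁺; x∈p∩q⁻; p⊆p∪q; q⊆p∪q; p─q⊆p; x∈p∧x∉q⇒x∈p─q)
open import Data.Product using (∃; _×_; _,_; proj₁; proj₂)
open import Data.Sum using (inj₁; inj₂; [_,_]′)
open import Data.Empty using (⊥-elim)
open import Function using (_∘_)
open import Relation.Nullary using (¬_; yes; no; contradiction)
open import Relation.Binary.PropositionalEquality using (_≡_; _≢_; refl; cong; trans)

-- Since N⁺(Q) is unreachable from S₁ in D − X, a path from S₁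
-- avoiding X ∩ (Q ∪ N⁺(Q)) can never leave Q, so this set is still an S₁-(W ∖ S₁)
-- separator; hence |N⁺(Q)| ≤ |X ∩ (Q ∪ N⁺(Q))| and X′ = (X ∖ (Q ∪ N⁺(Q))) ∪ N⁺(Q)
-- is no larger than X.  Once N⁺(Q) is deleted no path leaves Q, so every strong
-- component of D − X′ lies inside the ℋ-free set Q or entirely outside Q, where
-- D − X′ and D − X agree; likewise every path into a part Sⱼ with j > 1 ends
-- outside Q and is therefore already a path of D − X.

∣p∪q∣≤∣p∣+∣q∣ : ∀ {n} (p q : Subset n) → ∣ p ∪ q ∣ ≤ ∣ p ∣ + ∣ q ∣
∣p∪q∣≤∣p∣+∣q∣ []            []            = z≤n
∣p∪q∣≤∣p∣+∣q∣ (outside ∷ p) (outside ∷ q) = ∣p∪q∣≤∣p∣+∣q∣ p q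
∣p∪q∣≤∣p∣+∣q∣ (inside  ∷ p) (outside ∷ q) = s≤s (∣p∪q∣≤∣p∣+∣q∣ p q)
∣p∪q∣≤∣p∣+∣q∣ (outside ∷ p) (inside  ∷ q) rewrite +-suc ∣ p ∣ ∣ q ∣ = s≤s (∣p∪q∣≤∣p∣+∣q∣ p q)
∣p∪q∣≤∣p∣+∣q∣ (inside  ∷ p) (inside  ∷ q) rewrite +-suc ∣ p ∣ ∣ q ∣ =
  s≤s (m≤n⇒m≤1+n (∣p∪q∣≤∣p∣+∣q∣ p q))

∣p─q∣+∣p∩q∣≡∣p∣ : ∀ {n} (p q : Subset n) → ∣ p ─ q ∣ + ∣ p ∩ q ∣ ≡ ∣ p ∣
∣p─q∣+∣p∩q∣≡∣p∣ []            []            = refl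
∣p─q∣+∣p∩q∣≡∣p∣ (outside ∷ p) (outside ∷ q) = ∣p─q∣+∣p∩q∣≡∣p∣ p q
∣p─q∣+∣p∩q∣≡∣p∣ (outside ∷ p) (inside  ∷ q) = ∣p─q∣+∣p∩q∣≡∣p∣ p q
∣p─q∣+∣p∩q∣≡∣p∣ (inside  ∷ p) (outside ∷ q) = cong suc (∣p─q∣+∣p∩q∣≡∣p∣ p q)
∣p─q∣+∣p∩q∣≡∣p∣ (inside  ∷ p) (inside  ∷ q) =
  trans (+-suc ∣ p ─ q ∣ ∣ p ∩ q ∣) (cong suc (∣p─q∣+∣p∩q∣≡∣p∣ p q))

∣p─q∪r∣≤∣p∣ : ∀ {n} (p q r : Subset n) → ∣ r ∣ ≤ ∣ p ∩ q ∣ → ∣ (p ─ q) ∪ r ∣ ≤ ∣ p ∣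
∣p─q∪r∣≤∣p∣ p q r ∣r∣≤∣p∩q∣ = begin
  ∣ (p ─ q) ∪ r ∣        ≤⟨ ∣p∪q∣≤∣p∣+∣q∣ (p ─ q) r ⟩
  ∣ p ─ q ∣ + ∣ r ∣      ≤⟨ +-monoʳ-≤ ∣ p ─ q ∣ ∣r∣≤∣p∩q∣ ⟩
  ∣ p ─ q ∣ + ∣ p ∩ q ∣  ≡⟨ ∣p─q∣+∣p∩q∣≡∣p∣ p q ⟩
  ∣ p ∣                  ∎
  where open ≤-Reasoning

x∈p∧x∉p─q⇒x∈q : ∀ {n} {x : Fin n} {p q : Subset n} → x ∈ p → x ∉ p ─ q → x ∈ q
x∈p∧x∉p─q⇒x∈q {x = x} {q = q} x∈p x∉p─q with x ∈? q
... | yes x∈q = x∈q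
... | no  x∉q = contradiction (x∈p∧x∉q⇒x∈p─q x∈p x∉q) x∉p─q

q⊆p∪q─p : ∀ {n} (p q : Subset n) → q ⊆ p ∪ (q ─ p)
q⊆p∪q─p p q {x} x∈q with x ∈? p
... | yes x∈p = x∈p∪q⁺ (inj₁ x∈p)
... | no  x∉p = x∈p∪q⁺ (inj₂ (x∈p∧x∉q⇒x∈p─q x∈q x∉p))

p⊆q⇒p∪q─p⊆q : ∀ {n} {p q : Subset n} → p ⊆ q → p ∪ (q ─ p) ⊆ q
p⊆q⇒p∪q─p⊆q {p = p} {q} p⊆q = [ p⊆q , p─q⊆p q p ]′ ∘ x∈p∪q⁻ p (q ─ p)

i<j⇒j≢0 : ∀ {m} {i j : Fin (suc m)} → i < j → j ≢ zero
i<j⇒j≢0 {j = suc _} _ ()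

module _ {n : ℕ} (D : Digraph n) where

  PathAvoid-source∉ : ∀ {Y u v} → PathAvoid D Y u v → u ∉ Y
  PathAvoid-source∉ (here u∉Y)     = u∉Y
  PathAvoid-source∉ (step u∉Y _ _) = u∉Y

  PathAvoid-source∉-∩ : ∀ {p q u v} → PathAvoid D (p ∩ q) u v → u ∈ q → u ∉ p
  PathAvoid-source∉-∩ path u∈q u∈p = PathAvoid-source∉ path (x∈p∩q⁺ (u∈p , u∈q))

  PathAvoid-snoc : ∀ {Y u v w} → PathAvoid D Y u v → Edge D v w → w ∉ Y → PathAvoid D Y u w
  PathAvoid-snoc (here u∉Y)        e w∉Y = step u∉Y e (here w∉Y)
  PathAvoid-snoc (step u∉Y e′ path) e w∉Y = step u∉Y e′ (PathAvoid-snoc path e w∉Y)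

  module _ (Q : Subset n) where

    PathAvoid-stays-in : ∀ {Y u v} → (∀ w → InOutNbr D Q w → w ∈ Y) →
                         PathAvoid D Y u v → u ∈ Q → v ∈ Q
    PathAvoid-stays-in N⁺Q⊆Y (here _) u∈Q = u∈Q
    PathAvoid-stays-in N⁺Q⊆Y (step {w = w} _ e path) u∈Q with w ∈? Q
    ... | yes w∈Q = PathAvoid-stays-in N⁺Q⊆Y path w∈Q
    ... | no  w∉Q = contradiction (N⁺Q⊆Y w (w∉Q , _ , u∈Q , e)) (PathAvoid-source∉ path)

    PathAvoid-transfer : ∀ {X Y v} → (∀ w → InOutNbr D Q w → w ∈ Y) →
                         (∀ x → x ∈ X → x ∉ Y → x ∈ Q) →
                         v ∉ Q → ∀ {u} → PathAvoid D Y u v → PathAvoid D X u v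
    PathAvoid-transfer {X} {Y} {v} N⁺Q⊆Y X─Y⊆Q v∉Q = go
      where
      source∉X : ∀ {u} → PathAvoid D Y u v → u ∉ X
      source∉X path u∈X =
        v∉Q (PathAvoid-stays-in N⁺Q⊆Y path (X─Y⊆Q _ u∈X (PathAvoid-source∉ path)))

      go : ∀ {u} → PathAvoid D Y u v → PathAvoid D X u v
      go path@(here _)       = here (source∉X path)
      go path@(step _ e rest) = step (source∉X path) e (go rest)

    IsDeletionSet-exchange : ∀ {ℋ X Y} → HFree ℋ D Q → (∀ w → InOutNbr D Q w → w ∈ Y) →
                             (∀ x → x ∈ X → x ∉ Y → x ∈ Q) →
                             IsDeletionSet ℋ D X → IsDeletionSet ℋ D Y
    IsDeletionSet-exchange {X = X} Q-free N⁺Q⊆Y X─Y⊆Q X-del H H∈ℋ e (avoids-Y , strong)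
      with map e (root H) ∈? Q
    ... | yes r∈Q = Q-free H H∈ℋ e λ a →
                      PathAvoid-stays-in N⁺Q⊆Y (proj₁ (strong (root H) a)) r∈Q
    ... | no  r∉Q = X-del H H∈ℋ e (avoids-X , λ a b →
                      PathAvoid-transfer N⁺Q⊆Y X─Y⊆Q (off-Q b) (proj₁ (strong a b)) ,
                      PathAvoid-transfer N⁺Q⊆Y X─Y⊆Q (off-Q a) (proj₂ (strong a b)))
      where
      off-Q : ∀ a → map e a ∉ Q
      off-Q a a∈Q = r∉Q (PathAvoid-stays-in N⁺Q⊆Y (proj₁ (strong a (root H))) a∈Q)

      avoids-X : ∀ a → map e a ∉ X
      avoids-X a a∈X = off-Q a (X─Y⊆Q _ a∈X (avoids-Y a))

    InReach-trapped : ∀ {S X N u v} → (∀ w → InOutNbr D Q w → w ∈ N) →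
                      (∀ w → InReach D S X w → w ∉ N) →
                      InReach D S X u → u ∈ Q → PathAvoid D (X ∩ (Q ∪ N)) u v → v ∈ Q
    InReach-trapped _ _ _ u∈Q (here _) = u∈Q
    InReach-trapped N⁺Q⊆N unreached (s , s∈S , s⇝u) u∈Q (step {w = w} _ e path) with w ∈? Q
    ... | yes w∈Q =
      InReach-trapped N⁺Q⊆N unreached
        (s , s∈S , PathAvoid-snoc s⇝u e (PathAvoid-source∉-∩ path (x∈p∪q⁺ (inj₁ w∈Q))))
        w∈Q path
    ... | no  w∉Q = ⊥-elim (unreached w
        (s , s∈S , PathAvoid-snoc s⇝u e (PathAvoid-source∉-∩ path (x∈p∪q⁺ (inj₂ w∈N))))
        w∈N)
      where w∈N = N⁺Q⊆N w (w∉Q , _ , u∈Q , e)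

    IsSeparator-X∩[Q∪N] : ∀ {S T X N} → S ⊆ Q → Disjoint Q T → Disjoint X (S ∪ T) →
                          (∀ w → InOutNbr D Q w → w ∈ N) →
                          (∀ w → InReach D S X w → w ∉ N) →
                          IsSeparator D S T (X ∩ (Q ∪ N))
    IsSeparator-X∩[Q∪N] {S} {X = X} {N} S⊆Q Q∩T=∅ X∩[S∪T]=∅ N⁺Q⊆N unreached =
      (λ v v∈C → X∩[S∪T]=∅ v (proj₁ (x∈p∩q⁻ X (Q ∪ N) v∈C))) ,
      λ { (s , t , s∈S , t∈T , path) →
            Q∩T=∅ t (InReach-trapped N⁺Q⊆N unreached (s , s∈S , here (s∉X s∈S)) (S⊆Q s∈S) path) t∈T }
      where
      s∉X : ∀ {s} → s ∈ S → s ∉ X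
      s∉X s∈S s∈X = X∩[S∪T]=∅ _ s∈X (x∈p∪q⁺ (inj₁ s∈S))

lemma11 : (ℋ : Family) {n q : ℕ} (D : Digraph n) (S : Fin (suc q) → Subset n)
          (W : Subset n) (k : ℕ) → IsInstance ℋ D S W k →
          (Q : Subset n) → HFree ℋ D Q → S zero ⊆ Q → Disjoint Q (W ─ S zero) →
          (N⁺Q : Subset n) → (∀ v → v ∈ N⁺Q → InOutNbr D Q v) → (∀ v → InOutNbr D Q v → v ∈ N⁺Q) →
          IsMinSeparator D (S zero) (W ─ S zero) N⁺Q →
          (X : Subset n) → IsSolution ℋ D S W k X →
          (∀ v → InReach D (S zero) X v → v ∉ N⁺Q) →
          ∃ λ X′ → IsSolution ℋ D S W k X′ × N⁺Q ⊆ X′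
lemma11 ℋ {n} D S W k (_ , _ , _ , S-disjoint , S⊆W , _) Q Q-free S₀⊆Q Q∩T=∅ N _ N⁺Q⊆N
        ((N∩[S₀∪T]=∅ , _) , N-minimum) X (X-del , ∣X∣≤k , X∩W=∅ , X-separates) unreached =
  X′ , (IsDeletionSet-exchange D Q Q-free N⁺Q⊆X′ X─X′⊆Q X-del , ∣X′∣≤k , X′∩W=∅ , X′-separates) , N⊆X′
  where
  X′ : Subset n
  X′ = (X ─ (Q ∪ N)) ∪ N

  N⊆X′ : N ⊆ X′
  N⊆X′ = q⊆p∪q (X ─ (Q ∪ N)) N

  N⁺Q⊆X′ : ∀ v → InOutNbr D Q v → v ∈ X′
  N⁺Q⊆X′ v = N⊆X′ ∘ N⁺Q⊆N v

  X─X′⊆Q : ∀ x → x ∈ X → x ∉ X′ → x ∈ Q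
  X─X′⊆Q x x∈X x∉X′ with x∈p∪q⁻ Q N (x∈p∧x∉p─q⇒x∈q x∈X (x∉X′ ∘ p⊆p∪q N))
  ... | inj₁ x∈Q = x∈Q
  ... | inj₂ x∈N = contradiction (N⊆X′ x∈N) x∉X′

  ∣X′∣≤k : ∣ X′ ∣ ≤ k
  ∣X′∣≤k = ≤-trans (∣p─q∪r∣≤∣p∣ X (Q ∪ N) N (N-minimum _ C-separates)) ∣X∣≤k
    where
    C-separates = IsSeparator-X∩[Q∪N] D Q S₀⊆Q Q∩T=∅
      (λ v v∈X → X∩W=∅ v v∈X ∘ p⊆q⇒p∪q─p⊆q (S⊆W zero)) N⁺Q⊆N unreached

  X′∩W=∅ : Disjoint X′ W
  X′∩W=∅ v v∈X′ v∈W with x∈p∪q⁻ (X ─ (Q ∪ N)) N v∈X′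
  ... | inj₁ v∈X─ = X∩W=∅ v (p─q⊆p X (Q ∪ N) v∈X─) v∈W
  ... | inj₂ v∈N  = N∩[S₀∪T]=∅ v v∈N (q⊆p∪q─p (S zero) W v∈W)

  X′-separates : ∀ i j → i < j → ¬ PathBetween D X′ (S i) (S j)
  X′-separates i j i<j (s , t , s∈Sᵢ , t∈Sⱼ , path) =
    X-separates i j i<j (s , t , s∈Sᵢ , t∈Sⱼ , PathAvoid-transfer D Q N⁺Q⊆X′ X─X′⊆Q t∉Q path)
    where
    t∉Q : t ∉ Q
    t∉Q t∈Q = Q∩T=∅ t t∈Q
      (x∈p∧x∉q⇒x∈p─q (S⊆W j t∈Sⱼ) (S-disjoint j zero (i<j⇒j≢0 i<j) t t∈Sⱼ))
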